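{- If $\mathcal{A}$ and $\mathcal{B}$ are context trees over $A$ that have perfect memory, then the union at the root $\mathcal{A}\cup\mathcal{B}$ and the intersection at the root $\mathcal{A}\cap\mathcal{B}$ also have perfect memory.
   Context: Fix a finite alphabet $A=\{a_1,\dots,a_n\}$. A string is a finite sequence of letters of $A$ (possibly empty); $\overline{uv}$ denotes concatenation. A string $v$ is a postfix of $s$, written $v\prec s$, if $s=\overline{wv}$ for some string $w$. A context tree over $A$ is a finite rooted tree in which every non-root vertex is labeled by a letter of $A$, with no two siblings carrying the same label. A context is the string read along the path from a leaf to the root (leaf's label first, label of the root's child last); $\mathcal{T}^*$ is the set of contexts of $\mathcal{T}$. $\mathcal{T}$ is complete if every node is either a leaf or has exactly $n$ children. $\mathcal{T}$ has perfect memory if for every $c\in\mathcal{T}^*$ and every $i$ there exists $u\in\mathcal{T}^*$ with $u\prec\overline{ca_i}$ (such trees are complete). For nonempty complete context trees $\mathcal{A},\mathcal{B}$, the intersection at the root $\mathcal{A}\cap\mathcal{B}$ and union at the root $\mathcal{A}\cup\mathcal{B}$ are the context trees with contexts $(\mathcal{A}\cap\mathcal{B})^*=\{u: u\in\mathcal{A}^* \text{ and } \exists c\in\mathcal{B}^*,\ u\prec c;\ \text{or } u\in\mathcal{B}^* \text{ and } \exists c\in\mathcal{A}^*,\ u\prec c\}$, $(\mathcal{A}\cup\mathcal{B})^*=\{u: u\in\mathcal{A}^* \text{ and } \exists c\in\mathcal{B}^*,\ c\prec u;\ \text{or } u\in\mathcal{B}^* \text{ and } \exists c\in\mathcal{A}^*,\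 c\prec u\}$. -}

module Defs where

open import Data.Nat using (ℕ)
open import Data.Fin using (Fin)
open import Data.List using (List; []; _∷_; _++_; [_])
open import Data.Maybe using (Maybe; just; nothing)
open import Data.Product using (Σ; ∃; _×_; _,_)
open import Data.Sum using (_⊎_)
open import Relation.Binary.PropositionalEquality using (_≡_)

Str : ℕ → Set
Str n = List (Fin n)

_≺_ : ∀ {n} → Str n → Str n → Set
_≺_ {n} v s = Σ (Str n) λ w → s ≡ w ++ v

-- A context tree: a rooted tree; each node has, for every letter a,
-- at most one child labelled a (so siblings carry distinct labels).
-- Finiteness is automatic (inductive type, finitely branching).
data CTree (n : ℕ) : Set where
  node : (Fin n → Maybe (CTree n)) → CTree n

-- Ctx t u : u is a context of t, i.e. the string read along the path
-- from a leaf to the root (leaf's label first, root child's label last).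
data Ctx {n : ℕ} : CTree n → Str n → Set where
  leaf : ∀ {ch} → (∀ i → ch i ≡ nothing) → Ctx (node ch) []
  step : ∀ {ch} {t u} (i : Fin n) → ch i ≡ just t → Ctx t u →
         Ctx (node ch) (u ++ [ i ])

PerfectMemory : ∀ {n} → CTree n → Set
PerfectMemory {n} t =
  ∀ (c : Str n) → Ctx t c → ∀ (i : Fin n) →
    Σ (Str n) λ u → Ctx t u × (u ≺ (c ++ [ i ]))

InterCtx : ∀ {n} → CTree n → CTree n → Str n → Set
InterCtx {n} a b u =
  (Ctx a u × Σ (Str n) λ c → Ctx b c × (u ≺ c)) ⊎
  (Ctx b u × Σ (Str n) λ c → Ctx a c × (u ≺ c))

UnionCtx : ∀ {n} → CTree n → CTree n → Str n → Set
UnionCtx {n} a b u =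
  (Ctx a u × Σ (Str n) λ c → Ctx b c × (c ≺ u)) ⊎
  (Ctx b u × Σ (Str n) λ c → Ctx a c × (c ≺ u))

HasContexts : ∀ {n} → CTree n → (Str n → Set) → Set
HasContexts {n} t S = ∀ (u : Str n) → (Ctx t u → S u) × (S u → Ctx t u)

-- Perfect memory is a property of the set of contexts alone.  If p is a context
-- of 𝒜 anchored at a context c of ℬ (c a postfix of p), the successors in 𝒜
-- of p aᵢ and in ℬ of c aᵢ are both postfixes of p aᵢ, hence comparable; for
-- the union the longer one, for the intersection the shorter one, is again a
-- context of the combined set and a postfix of p aᵢ.
--
-- It remains to realise these sets by trees.  Read root-first, the union at
-- the root is the overlay of the two trees and the intersection is their
-- common part.  That these trees have exactly the prescribed contexts needs
-- completeness, which perfect memory forces: by induction on a word, it is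
-- comparable with some context, since the context following c aᵢ is a postfix
-- of c aᵢ.
module Submission where

open import Defs
open import Data.Nat using (ℕ)
open import Data.Fin using (Fin; zero; suc)
open import Data.List using (List; []; _∷_; _++_; [_]; reverse)
open import Data.List.Properties
  using (++-assoc; ∷-injectiveʳ; ++-monoid; reverse-++; unfold-reverse; reverse-involutive)
open import Data.List.Relation.Binary.Prefix.Heterogeneous using (Prefix; []; _∷_)
import Data.List.Relation.Binary.Prefix.Heterogeneous.Properties as Prefix
open import Data.List.Relation.Binary.Suffix.Heterogeneous.Properties using (fromPrefix; toPrefix-rev)
open import Data.List.Relation.Binary.Suffix.Propositional.Properties using (Suffix-as-∣ʳ; ∣ʳ-as-Suffix)
open import Data.Maybe using (Maybe; just; nothing)
open import Data.Product using (Σ; ∃; ∃₂; _×_; _,_; proj₁; proj₂)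
import Data.Product as Product
open import Data.Sum using (_⊎_; inj₁; inj₂)
import Data.Sum as Sum
open import Function using (_∘_; flip; case_of_)
open import Level using (0ℓ)
open import Relation.Binary.Core using (Rel)
open import Relation.Binary.PropositionalEquality using (_≡_; refl; sym; trans; cong; cong₂; subst)
open import Relation.Unary using (Pred; _⊆_; _≐_; _∪_)
open import Relation.Unary.Properties using (≐-sym)

module _ {A : Set} where

  Anchored : Rel (List A) 0ℓ → Pred (List A) 0ℓ → Pred (List A) 0ℓ → Pred (List A) 0ℓ
  Anchored R X Y u = X u × ∃ λ c → Y c × R c u

  -- UnionCtx 𝒜 ℬ and InterCtx 𝒜 ℬ are, by definition, BiAnchored _≺_ and
  -- BiAnchored (flip _≺_) applied to Ctx 𝒜 and Ctx ℬ.
  BiAnchored : Rel (List A) 0ℓ → Pred (List A) 0ℓ → Pred (List A) 0ℓ → Pred (List A) 0ℓ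
  BiAnchored R X Y = Anchored R X Y ∪ Anchored R Y X

module _ {n : ℕ} where

  ≺-trans : {u v s : Str n} → u ≺ v → v ≺ s → u ≺ s
  ≺-trans {u} (w , refl) (w′ , refl) = w′ ++ w , sym (++-assoc w′ w u)

  ≺-++ʳ : {u s : Str n} (z : Str n) → u ≺ s → (u ++ z) ≺ (s ++ z)
  ≺-++ʳ {u} z (w , refl) = w , ++-assoc w u z

  ≺-comparable : {u v s : Str n} → u ≺ s → v ≺ s → u ≺ v ⊎ v ≺ u
  ≺-comparable (w , refl) (w′ , e) = go w w′ e
    where
    go : ∀ w w′ {u v} → w ++ u ≡ w′ ++ v → u ≺ v ⊎ v ≺ u
    go []      w′       e = inj₂ (w′ , e)
    go (x ∷ w) []       e = inj₁ (x ∷ w , sym e)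
    go (x ∷ w) (y ∷ w′) e = go w w′ (∷-injectiveʳ e)

  PerfectMemoryˢ : Pred (Str n) 0ℓ → Set
  PerfectMemoryˢ X = ∀ c → X c → ∀ i → ∃ λ u → X u × u ≺ (c ++ [ i ])

  perfectMemoryˢ-≐ : {X Y : Pred (Str n) 0ℓ} → X ≐ Y → PerfectMemoryˢ X → PerfectMemoryˢ Y
  perfectMemoryˢ-≐ (X⊆Y , Y⊆X) pm c yc i =
    let (u , xu , u≺ci) = pm c (Y⊆X yc) i in u , X⊆Y xu , u≺ci

  module _ {X Y : Pred (Str n) 0ℓ} (pmX : PerfectMemoryˢ X) (pmY : PerfectMemoryˢ Y) where

    union-successor : ∀ {c} → Anchored _≺_ X Y c → ∀ i →
                      ∃ λ u → BiAnchored _≺_ X Y u × u ≺ (c ++ [ i ])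
    union-successor {c} (xc , d , yd , d≺c) i =
      let (u , xu , u≺ci) = pmX c xc i
          (v , yv , v≺di) = pmY d yd i
          v≺ci = ≺-trans v≺di (≺-++ʳ [ i ] d≺c)
      in case ≺-comparable u≺ci v≺ci of λ where
           (inj₁ u≺v) → v , inj₂ (yv , u , xu , u≺v) , v≺ci
           (inj₂ v≺u) → u , inj₁ (xu , v , yv , v≺u) , u≺ci

    inter-successor : ∀ {c} → Anchored (flip _≺_) X Y c → ∀ i →
                      ∃ λ u → BiAnchored (flip _≺_) X Y u × u ≺ (c ++ [ i ])
    inter-successor {c} (xc , d , yd , c≺d) i =
      let (u , xu , u≺ci) = pmX c xc i
          (v , yv , v≺di) = pmY d yd i
          u≺di = ≺-trans u≺ci (≺-++ʳ [ i ] c≺d)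
      in case ≺-comparable u≺di v≺di of λ where
           (inj₁ u≺v) → u , inj₁ (xu , v , yv , u≺v) , u≺ci
           (inj₂ v≺u) → v , inj₂ (yv , u , xu , v≺u) , ≺-trans v≺u u≺ci

  perfectMemory-union : {X Y : Pred (Str n) 0ℓ} → PerfectMemoryˢ X → PerfectMemoryˢ Y →
                        PerfectMemoryˢ (BiAnchored _≺_ X Y)
  perfectMemory-union pmX pmY c (inj₁ a) i = union-successor pmX pmY a i
  perfectMemory-union pmX pmY c (inj₂ a) i =
    Product.map₂ (Product.map₁ Sum.swap) (union-successor pmY pmX a i)

  perfectMemory-inter : {X Y : Pred (Str n) 0ℓ} → PerfectMemoryˢ X → PerfectMemoryˢ Y →
                        PerfectMemoryˢ (BiAnchored (flip _≺_) X Y)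
  perfectMemory-inter pmX pmY c (inj₁ a) i = inter-successor pmX pmY a i
  perfectMemory-inter pmX pmY c (inj₂ a) i =
    Product.map₂ (Product.map₁ Sum.swap) (inter-successor pmY pmX a i)

module _ {A : Set} where

  infix 4 _⊑_
  _⊑_ : Rel (List A) 0ℓ
  _⊑_ = Prefix _≡_

  ⊑-trans : {p q r : List A} → p ⊑ q → q ⊑ r → p ⊑ r
  ⊑-trans = Prefix.trans trans

  Comparable : Rel (List A) 0ℓ
  Comparable p q = p ⊑ q ⊎ q ⊑ p

  ⊑-comparable : {p q r : List A} → p ⊑ r → q ⊑ r → Comparable p q
  ⊑-comparable []            _             = inj₁ []
  ⊑-comparable (_ ∷ _)       []            = inj₂ []
  ⊑-comparable (refl ∷ p⊑r) (refl ∷ q⊑r) = Sum.map (refl ∷_) (refl ∷_) (⊑-comparable p⊑r q⊑r)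

  comparable-∷⁻ : {i j : A} {p q : List A} → Comparable (j ∷ p) (i ∷ q) → j ≡ i × Comparable p q
  comparable-∷⁻ (inj₁ (j≡i ∷ p⊑q)) = j≡i , inj₁ p⊑q
  comparable-∷⁻ (inj₂ (i≡j ∷ q⊑p)) = sym i≡j , inj₂ q⊑p

  PerfectMemoryʳ : Pred (List A) 0ℓ → Set
  PerfectMemoryʳ X = ∀ {r} → X r → ∀ i → ∃ λ q → X q × q ⊑ i ∷ r

  -- For the contexts of a tree this is completeness: every node is a leaf or
  -- has all n children.
  Covering : Pred (List A) 0ℓ → Set
  Covering X = ∀ x → ∃ λ r → X r × Comparable r x

  perfectMemoryʳ⇒covering : {X : Pred (List A) 0ℓ} → ∃ X → PerfectMemoryʳ X → Covering X
  perfectMemoryʳ⇒covering (r , xr) pm [] = r , xr , inj₂ []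
  perfectMemoryʳ⇒covering inhabited pm (i ∷ x) =
    let (r , xr , r~x) = perfectMemoryʳ⇒covering inhabited pm x
        (q , xq , q⊑ir) = pm xr i
    in q , xq , (case r~x of λ where
         (inj₁ r⊑x) → inj₁ (⊑-trans q⊑ir (refl ∷ r⊑x))
         (inj₂ x⊑r) → ⊑-comparable q⊑ir (refl ∷ x⊑r))

  record Mirror (X X′ : Pred (List A) 0ℓ) : Set where
    constructor mirror
    field
      forward  : X ⊆ X′ ∘ reverse
      backward : X′ ⊆ X ∘ reverse

  record Mirror₂ (R R′ : Rel (List A) 0ℓ) : Set where
    constructor mirror₂
    field
      forward  : ∀ {u v} → R u v → R′ (reverse u) (reverse v)
      backward : ∀ {u v} → R′ u v → R (reverse u) (reverse v)

  private variable
    R R′ : Rel (List A) 0ℓ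
    X X′ Y Y′ : Pred (List A) 0ℓ

  mirror₂-flip : Mirror₂ R R′ → Mirror₂ (flip R) (flip R′)
  mirror₂-flip (mirror₂ to from) = mirror₂ to from

  mirror-anchored : Mirror₂ R R′ → Mirror X X′ → Mirror Y Y′ →
                    Mirror (Anchored R X Y) (Anchored R′ X′ Y′)
  mirror-anchored (mirror₂ r r′) (mirror x x′) (mirror y y′) = mirror
    (λ (xu , c , yc , rcu) → x xu , reverse c , y yc , r rcu)
    (λ (xu , c , yc , rcu) → x′ xu , reverse c , y′ yc , r′ rcu)

  mirror-biAnchored : Mirror₂ R R′ → Mirror X X′ → Mirror Y Y′ →
                      Mirror (BiAnchored R X Y) (BiAnchored R′ X′ Y′)
  mirror-biAnchored r mx my =
    let mirror f f′ = mirror-anchored r mx my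
        mirror g g′ = mirror-anchored r my mx
    in mirror (Sum.map f g) (Sum.map f′ g′)

  mirror-≐ : Mirror X X′ → Mirror Y Y′ → X′ ≐ Y′ → X ≐ Y
  mirror-≐ {X = X} {Y = Y} (mirror x x′) (mirror y y′) (X′⊆Y′ , Y′⊆X′) =
    (λ {u} xu → subst Y (reverse-involutive u) (y′ (X′⊆Y′ (x xu)))) ,
    (λ {u} yu → subst X (reverse-involutive u) (x′ (Y′⊆X′ (y yu))))

module _ {n : ℕ} where
  open import Algebra.Properties.Monoid.Divisibility (++-monoid (Fin n)) using (_,_)

  mirror-≺ : Mirror₂ (_≺_ {n}) _⊑_
  mirror-≺ = mirror₂ (λ (w , e) → toPrefix-rev (∣ʳ-as-Suffix (w , sym e)))
                     (λ u⊑v → let (w , e) = Suffix-as-∣ʳ (fromPrefix u⊑v) in w , sym e)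

  mirror-perfectMemory : {X X′ : Pred (Str n) 0ℓ} →
                         Mirror X X′ → PerfectMemoryˢ X → PerfectMemoryʳ X′
  mirror-perfectMemory (mirror x x′) pm {r} xr i =
    let (u , xu , u≺ri) = pm (reverse r) (x′ xr) i
    in reverse u , x xu , subst (reverse u ⊑_) reverse-snoc (Mirror₂.forward mirror-≺ u≺ri)
    where
    reverse-snoc : reverse (reverse r ++ [ i ]) ≡ i ∷ r
    reverse-snoc = trans (reverse-++ (reverse r) [ i ]) (cong (i ∷_) (reverse-involutive r))

nothing-or-just : ∀ {m} {X : Set} (h : Fin m → Maybe X) →
                  (∀ i → h i ≡ nothing) ⊎ ∃₂ λ i x → h i ≡ just x
nothing-or-just {ℕ.zero}  h = inj₁ λ ()
nothing-or-just {ℕ.suc m} h with h zero in e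
... | just x  = inj₂ (zero , x , e)
... | nothing = Sum.map (λ none → λ { zero → e ; (suc i) → none i })
                        (λ (i , x , e′) → suc i , x , e′)
                        (nothing-or-just (h ∘ suc))

module _ {n : ℕ} where

  data RCtx : CTree n → Str n → Set where
    leaf : ∀ {ch} → (∀ i → ch i ≡ nothing) → RCtx (node ch) []
    step : ∀ {ch t u} (i : Fin n) → ch i ≡ just t → RCtx t u → RCtx (node ch) (i ∷ u)

  mirror-Ctx : {t : CTree n} → Mirror (Ctx t) (RCtx t)
  mirror-Ctx = mirror Ctx⇒RCtx RCtx⇒Ctx
    where
    Ctx⇒RCtx : ∀ {t u} → Ctx t u → RCtx t (reverse u)
    Ctx⇒RCtx (leaf none)         = leaf none
    Ctx⇒RCtx (step {u = u} i e c) =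
      subst (RCtx _) (sym (reverse-++ u [ i ])) (step i e (Ctx⇒RCtx c))

    RCtx⇒Ctx : ∀ {t u} → RCtx t u → Ctx t (reverse u)
    RCtx⇒Ctx (leaf none)         = leaf none
    RCtx⇒Ctx (step {u = u} i e c) =
      subst (Ctx _) (sym (unfold-reverse i u)) (step i e (RCtx⇒Ctx c))

  rctx-exists : (t : CTree n) → ∃ (RCtx t)
  rctx-exists (node ch) with nothing-or-just ch
  ... | inj₁ none          = [] , leaf none
  ... | inj₂ (i , t , e) = Product.map (i ∷_) (step i e) (below (ch i) e)
    where
    below : ∀ {t} (m : Maybe (CTree n)) → m ≡ just t → ∃ (RCtx t)
    below (just t) refl = rctx-exists t

  perfectMemory⇒covering : (t : CTree n) → PerfectMemory t → Covering (RCtx t)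
  perfectMemory⇒covering t pm =
    perfectMemoryʳ⇒covering (rctx-exists t) (mirror-perfectMemory mirror-Ctx pm)

  module _ {ch : Fin n → Maybe (CTree n)} (cov : Covering (RCtx (node ch))) where

    covering-child : ∀ {i t} → ch i ≡ just t → Covering (RCtx t)
    covering-child {i} e x with cov (i ∷ x)
    ... | [] , leaf none , _ with trans (sym e) (none i)
    ...   | ()
    covering-child {i} e x | j ∷ r , step j e′ c , jr~ix with comparable-∷⁻ jr~ix
    ... | refl , r~x with refl ← trans (sym e) e′ = r , c , r~x

    covering-leaf : ∀ {i} → ch i ≡ nothing → ∀ j → ch j ≡ nothing
    covering-leaf {i} e with cov [ i ]
    ... | [] , leaf none , _ = none
    ... | j ∷ r , step j e′ c , jr~i with comparable-∷⁻ jr~i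
    ...   | refl , _ with trans (sym e) e′
    ...     | ()

  union : CTree n → CTree n → CTree n
  unionᴹ : Maybe (CTree n) → Maybe (CTree n) → Maybe (CTree n)

  union (node f) (node g) = node λ i → unionᴹ (f i) (g i)

  unionᴹ nothing  y        = y
  unionᴹ (just a) nothing  = just a
  unionᴹ (just a) (just b) = just (union a b)

  inter : CTree n → CTree n → CTree n
  interᴹ : Maybe (CTree n) → Maybe (CTree n) → Maybe (CTree n)

  inter (node f) (node g) = node λ i → interᴹ (f i) (g i)

  interᴹ nothing  _        = nothing
  interᴹ (just _) nothing  = nothing
  interᴹ (just a) (just b) = just (inter a b)

  unionᴹ-nothing⁻ : ∀ {x y} → unionᴹ x y ≡ nothing → x ≡ nothing × y ≡ nothing
  unionᴹ-nothing⁻ {nothing} {nothing} _  = refl , refl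
  unionᴹ-nothing⁻ {nothing} {just _}  ()
  unionᴹ-nothing⁻ {just _}  {nothing} ()
  unionᴹ-nothing⁻ {just _}  {just _}  ()

  unionᴹ-just⁻ : ∀ {x y t} → unionᴹ x y ≡ just t →
                 (x ≡ just t × y ≡ nothing) ⊎ (x ≡ nothing × y ≡ just t) ⊎
                 ∃₂ λ a b → x ≡ just a × y ≡ just b × t ≡ union a b
  unionᴹ-just⁻ {just _}  {nothing} refl = inj₁ (refl , refl)
  unionᴹ-just⁻ {nothing} {just _}  refl = inj₂ (inj₁ (refl , refl))
  unionᴹ-just⁻ {just a}  {just b}  refl = inj₂ (inj₂ (a , b , refl , refl , refl))

  interᴹ-nothingʳ : ∀ x → interᴹ x nothing ≡ nothing
  interᴹ-nothingʳ nothing  = refl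
  interᴹ-nothingʳ (just _) = refl

  interᴹ-nothing⁻ : ∀ {x y a} → x ≡ just a → interᴹ x y ≡ nothing → y ≡ nothing
  interᴹ-nothing⁻ {y = nothing} _ _ = refl
  interᴹ-nothing⁻ {y = just _} refl ()

  interᴹ-just⁻ : ∀ {x y t} → interᴹ x y ≡ just t →
                 ∃₂ λ a b → x ≡ just a × y ≡ just b × t ≡ inter a b
  interᴹ-just⁻ {just a} {just b} refl = a , b , refl , refl , refl

  biAnchored-step : ∀ {R : Rel (Str n) 0ℓ} {f g a b i p} →
                    (∀ {u v} → R u v → R (i ∷ u) (i ∷ v)) → f i ≡ just a → g i ≡ just b →
                    BiAnchored R (RCtx a) (RCtx b) p →
                    BiAnchored R (RCtx (node f)) (RCtx (node g)) (i ∷ p)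
  biAnchored-step {i = i} R-∷ ef eg (inj₁ (ca , c , cb , r)) =
    inj₁ (step i ef ca , i ∷ c , step i eg cb , R-∷ r)
  biAnchored-step {i = i} R-∷ ef eg (inj₂ (cb , c , ca , r)) =
    inj₂ (step i eg cb , i ∷ c , step i ef ca , R-∷ r)

  module _ {a b : CTree n} where

    union⁺ : BiAnchored _⊑_ (RCtx a) (RCtx b) ⊆ RCtx (union a b)
    union⁺ (inj₁ (ca , _ , cb , q⊑p)) = left ca cb q⊑p
      where
      left : ∀ {a b p q} → RCtx a p → RCtx b q → q ⊑ p → RCtx (union a b) p
      left (leaf noneᵃ) (leaf noneᵇ) _ = leaf λ i → cong₂ unionᴹ (noneᵃ i) (noneᵇ i)
      left (step i ea ca) (leaf noneᵇ) _ = step i (cong₂ unionᴹ ea (noneᵇ i)) ca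
      left (step i ea ca) (step i eb cb) (refl ∷ q⊑p) =
        step i (cong₂ unionᴹ ea eb) (left ca cb q⊑p)
    union⁺ (inj₂ (cb , _ , ca , q⊑p)) = right cb ca q⊑p
      where
      right : ∀ {a b p q} → RCtx b p → RCtx a q → q ⊑ p → RCtx (union a b) p
      right (leaf noneᵇ) (leaf noneᵃ) _ = leaf λ i → cong₂ unionᴹ (noneᵃ i) (noneᵇ i)
      right (step i eb cb) (leaf noneᵃ) _ = step i (cong₂ unionᴹ (noneᵃ i) eb) cb
      right (step i eb cb) (step i ea ca) (refl ∷ q⊑p) =
        step i (cong₂ unionᴹ ea eb) (right cb ca q⊑p)

    inter⁺ : BiAnchored (flip _⊑_) (RCtx a) (RCtx b) ⊆ RCtx (inter a b)
    inter⁺ (inj₁ (ca , _ , cb , p⊑q)) = left ca cb p⊑q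
      where
      left : ∀ {a b p q} → RCtx a p → RCtx b q → p ⊑ q → RCtx (inter a b) p
      left {b = node g} (leaf noneᵃ) _ _ = leaf λ i → cong (λ x → interᴹ x (g i)) (noneᵃ i)
      left (step i ea ca) (step i eb cb) (refl ∷ p⊑q) =
        step i (cong₂ interᴹ ea eb) (left ca cb p⊑q)
    inter⁺ (inj₂ (cb , _ , ca , p⊑q)) = right cb ca p⊑q
      where
      right : ∀ {a b p q} → RCtx b p → RCtx a q → p ⊑ q → RCtx (inter a b) p
      right {a = node f} (leaf noneᵇ) _ _ =
        leaf λ i → trans (cong (interᴹ (f i)) (noneᵇ i)) (interᴹ-nothingʳ (f i))
      right (step i eb cb) (step i ea ca) (refl ∷ p⊑q) =
        step i (cong₂ interᴹ ea eb) (right cb ca p⊑q)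

  union⁻ : ∀ {a b} → Covering (RCtx a) → Covering (RCtx b) →
           RCtx (union a b) ⊆ BiAnchored _⊑_ (RCtx a) (RCtx b)
  union⁻ {node f} {node g} _ _ (leaf none) =
    inj₁ ( leaf (proj₁ ∘ unionᴹ-nothing⁻ ∘ none)
         , [] , leaf (proj₂ ∘ unionᴹ-nothing⁻ ∘ none) , [])
  union⁻ {node f} {node g} covᵃ covᵇ (step i e c) with unionᴹ-just⁻ e
  ... | inj₁ (ea , eb)        = inj₁ (step i ea c , [] , leaf (covering-leaf covᵇ eb) , [])
  ... | inj₂ (inj₁ (ea , eb)) = inj₂ (step i eb c , [] , leaf (covering-leaf covᵃ ea) , [])
  ... | inj₂ (inj₂ (_ , _ , ea , eb , refl)) =
    biAnchored-step {R = _⊑_} (refl ∷_) ea eb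
      (union⁻ (covering-child covᵃ ea) (covering-child covᵇ eb) c)

  -- At a common leaf, either 𝒜 is a leaf or it has a child k that ℬ lacks, and
  -- then completeness makes ℬ a leaf.
  inter⁻ : ∀ {a b} → Covering (RCtx a) → Covering (RCtx b) →
           RCtx (inter a b) ⊆ BiAnchored (flip _⊑_) (RCtx a) (RCtx b)
  inter⁻ {node f} {node g} covᵃ covᵇ (leaf none) with covᵃ []
  ... | [] , leaf noneᵃ , _ =
    let (c , cb , _) = covᵇ [] in inj₁ (leaf noneᵃ , c , cb , [])
  ... | k ∷ r , step k ea ca , _ =
    inj₂ (leaf (covering-leaf covᵇ (interᴹ-nothing⁻ ea (none k))) , k ∷ r , step k ea ca , [])
  inter⁻ {node f} {node g} covᵃ covᵇ (step i e c) with interᴹ-just⁻ e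
  ... | _ , _ , ea , eb , refl =
    biAnchored-step {R = flip _⊑_} (refl ∷_) ea eb
      (inter⁻ (covering-child covᵃ ea) (covering-child covᵇ eb) c)

  module _ {a b : CTree n} (covᵃ : Covering (RCtx a)) (covᵇ : Covering (RCtx b)) where

    contexts-union : Ctx (union a b) ≐ UnionCtx a b
    contexts-union =
      mirror-≐ mirror-Ctx (mirror-biAnchored mirror-≺ mirror-Ctx mirror-Ctx)
               (union⁻ covᵃ covᵇ , union⁺)

    contexts-inter : Ctx (inter a b) ≐ InterCtx a b
    contexts-inter =
      mirror-≐ mirror-Ctx (mirror-biAnchored (mirror₂-flip mirror-≺) mirror-Ctx mirror-Ctx)
               (inter⁻ covᵃ covᵇ , inter⁺)

  ≐⇒HasContexts : {t : CTree n} {S : Pred (Str n) 0ℓ} → Ctx t ≐ S → HasContexts t S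
  ≐⇒HasContexts (to , from) u = to , from

mainTheorem4 : ∀ {n : ℕ} (𝒜 ℬ : CTree n) →
    PerfectMemory 𝒜 → PerfectMemory ℬ →
    (Σ (CTree n) λ 𝒰 → HasContexts 𝒰 (UnionCtx 𝒜 ℬ) × PerfectMemory 𝒰) ×
    (Σ (CTree n) λ ℐ → HasContexts ℐ (InterCtx 𝒜 ℬ) × PerfectMemory ℐ)
mainTheorem4 𝒜 ℬ pm𝒜 pmℬ =
    ( union 𝒜 ℬ , ≐⇒HasContexts ctx∪
    , perfectMemoryˢ-≐ (≐-sym ctx∪) (perfectMemory-union pm𝒜 pmℬ))
  , ( inter 𝒜 ℬ , ≐⇒HasContexts ctx∩
    , perfectMemoryˢ-≐ (≐-sym ctx∩) (perfectMemory-inter pm𝒜 pmℬ))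
  where
  cov𝒜 : Covering (RCtx 𝒜)
  cov𝒜 = perfectMemory⇒covering 𝒜 pm𝒜
  covℬ : Covering (RCtx ℬ)
  covℬ = perfectMemory⇒covering ℬ pmℬ
  ctx∪ : Ctx (union 𝒜 ℬ) ≐ UnionCtx 𝒜 ℬ
  ctx∪ = contexts-union cov𝒜 covℬ
  ctx∩ : Ctx (inter 𝒜 ℬ) ≐ InterCtx 𝒜 ℬ
  ctx∩ = contexts-inter cov𝒜 covℬ
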